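{- Let $n,k,g$ be positive integers with $n>18k$ and $1<g\le n/2$. Define $D(g,k,n):=\{|gx|_n-|gy|_n : 1\le x,y<k\}$ (integers $x,y$). Then $|D(g,k,n)\cap\{1,2,\dots,k-1\}|<2k/3$.
   Context: For $x\in\mathbb{Z}_n$ (or an integer read modulo $n$), $|x|_n:=\min(x,-x)$ where $\pm x$ are reduced into $\{0,1,\dots,n-1\}$; the differences $|gx|_n-|gy|_n$ are computed in $\mathbb{Z}$. -}

module Defs where

open import Data.Nat using (ℕ; zero; suc; _+_; _*_; _∸_; _⊓_; _%_; NonZero; _≡ᵇ_)
open import Data.Bool using (Bool; true; false; _∧_)
open import Data.List using (List; filter; length; upTo; drop)
open import Data.Bool.ListAction using (any)
open import Data.Bool using (T)
open import Relation.Nullary.Decidable using (T?)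

-- |x|_n := min (x mod n) ((-x) mod n), both reduced into {0,…,n-1}.
-- (-x) mod n is computed as (n ∸ x mod n) mod n.
∣_∣[_] : ℕ → (n : ℕ) → .{{NonZero n}} → ℕ
∣ x ∣[ n ] = (x % n) ⊓ ((n ∸ (x % n)) % n)

range1 : ℕ → List ℕ
range1 m = drop 1 (upTo m)

-- Boolean test: d ∈ D(g,k,n), for d a natural number, i.e. there are
-- 1 ≤ x,y < k with |gx|_n - |gy|_n = d  (as integers, equivalently
-- |gx|_n = |gy|_n + d in ℕ since d ≥ 0).
inD : (g k n : ℕ) → .{{NonZero n}} → ℕ → Bool
inD g k n d =
  any (λ x → any (λ y → ∣ g * x ∣[ n ] ≡ᵇ (∣ g * y ∣[ n ] + d)) (range1 k)) (range1 k)

countD : (g k n : ℕ) → .{{NonZero n}} → ℕ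
countD g k n = length (filter (λ d → T? (inD g k n d)) (range1 k))

module Submission where

-- If d = |gx|_n − |gy|_n with 1 ≤ x, y < k, pick signs εᵢ = ±1 with ε₁gx ≡ |gx|_n and
-- ε₂gy ≡ |gy|_n (mod n); then z = ε₁x − ε₂y satisfies gz ≡ d (mod n) and |z| ≤ 2k − 2.
-- Write n = 2g + e.  If g ≤ 2k − 2 or 2 ≤ e ≤ 2k − 2, reducing gz ≡ d modulo m = g, resp.
-- m = e, gives d ≡ a·t (mod m) for a fixed a and some |t| ≤ m/9 (because n > 18k), so d lies
-- in one of 1 + 2⌊m/9⌋ residue classes modulo m, each of which meets [1, k) at most
-- ⌊(k − 2)/m⌋ + 1 times.  If e = 0 then n ∣ 2d, which is impossible; if e = 1 then
-- 2|gx|_n ∈ {x, n − x}, which forces 2d ≤ k − 2.  In the remaining case g and e both exceed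
-- 2k − 2, so gδ ≡ v (mod n) with |δ| ≤ 2 and |v| ≤ 2k − 2 forces v = 0: the values |z| ≥ 2
-- attached to distinct d are at distance at least 3 inside [2, 2k − 2].

open import Defs
open import Data.Bool using (T)
open import Data.Fin using (Fin; zero; suc; fromℕ<; combine)
open import Data.Fin.Properties using (injective⇒≤; fromℕ<-injective; combine-injective)
open import Data.Integer as ℤ using (ℤ; +_; -[1+_]; 0ℤ; 1ℤ; -1ℤ; ∣_∣; _⊖_)
import Data.Integer.Properties as ℤ
import Data.Integer.Tactic.RingSolver as ℤ
open import Algebra.Properties.AbelianGroup ℤ.+-0-abelianGroup using (∙-cancelʳ)
open import Data.Integer.Divisibility.Signed
  using (_∣_; divides; ∣ᵤ⇒∣; ∣⇒∣ᵤ; ∣-refl; ∣m∣n⇒∣m+n; ∣m∣n⇒∣m-n; ∣n⇒∣m*n)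
open import Data.List using (List; []; _∷_; length; lookup; filter)
open import Data.List.Membership.Propositional.Properties using (∈-lookup)
open import Data.List.Relation.Unary.All as All using (All)
import Data.List.Relation.Unary.All.Properties as All
import Data.List.Relation.Unary.AllPairs as AllPairs
open import Data.List.Relation.Unary.Any.Properties using (any⁻)
open import Data.List.Relation.Unary.Unique.Propositional using (Unique)
import Data.List.Relation.Unary.Unique.Propositional.Properties as Unique
open import Data.Nat as ℕ
  using (ℕ; zero; suc; _+_; _*_; _∸_; _⊓_; _⊔_; _%_; _/_; _≤_; _<_; _≤?_; z≤n; s≤s; z<s; NonZero; >-nonZero)
import Data.Nat.Divisibility as ℕ
import Data.Nat.Tactic.RingSolver as ℕ
open import Data.Nat.DivMod
open import Data.Nat.Properties
open import Data.Product using (∃-syntax; _×_; _,_)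
open import Data.Sum using (_⊎_; inj₁; inj₂)
open import Function.Definitions using (Injective)
open import Relation.Binary.PropositionalEquality
  using (_≡_; refl; sym; trans; cong; cong₂; subst; subst₂; module ≡-Reasoning)
open import Relation.Nullary using (¬_; Dec; yes; no; contradiction)
open import Relation.Nullary.Decidable using (T?)

-- Counting by injective codes

lookup-injective : ∀ {a} {A : Set a} {xs : List A} → Unique xs → Injective _≡_ _≡_ (lookup xs)
lookup-injective {xs = _ ∷ _} (_  AllPairs.∷ _) {zero}  {zero}  _  = refl
lookup-injective {xs = _ ∷ _} (x∉ AllPairs.∷ _) {zero}  {suc j} eq = contradiction eq (All.lookup x∉ (∈-lookup j))
lookup-injective {xs = _ ∷ _} (x∉ AllPairs.∷ _) {suc i} {zero}  eq = contradiction (sym eq) (All.lookup x∉ (∈-lookup i))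
lookup-injective {xs = _ ∷ _} (_  AllPairs.∷ u) {suc i} {suc j} eq = cong suc (lookup-injective u eq)

length≤-by-code : ∀ {a p} {A : Set a} {P : A → Set p} {M : ℕ} {xs : List A}
  (code : ∀ {x} → P x → Fin M) →
  (∀ {x y} (px : P x) (py : P y) → code px ≡ code py → x ≡ y) →
  Unique xs → All P xs → length xs ≤ M
length≤-by-code code code-injective u pxs = injective⇒≤ λ {i} {j} eq →
  lookup-injective u (code-injective (All.lookup pxs (∈-lookup i)) (All.lookup pxs (∈-lookup j)) eq)

Unit : ℤ → Set
Unit ε = ε ≡ 1ℤ ⊎ ε ≡ -1ℤ

∣unit*i∣≡∣i∣ : ∀ {ε} → Unit ε → ∀ i → ∣ ε ℤ.* i ∣ ≡ ∣ i ∣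
∣unit*i∣≡∣i∣ (inj₁ refl) i = cong ∣_∣ (ℤ.*-identityˡ i)
∣unit*i∣≡∣i∣ (inj₂ refl) i = trans (cong ∣_∣ (ℤ.-1*i≡-i i)) (ℤ.∣-i∣≡∣i∣ i)

+∣i∣≡unit*i : ∀ i → ∃[ ε ] Unit ε × + ∣ i ∣ ≡ ε ℤ.* i
+∣i∣≡unit*i i with ℤ.+∣i∣≡i⊎+∣i∣≡-i i
... | inj₁ eq = 1ℤ  , inj₁ refl , trans eq (sym (ℤ.*-identityˡ i))
... | inj₂ eq = -1ℤ , inj₂ refl , trans eq (sym (ℤ.-1*i≡-i i))

+[m∸n]≡+m-+n : ∀ {m n} → n ≤ m → + (m ∸ n) ≡ + m ℤ.- + n
+[m∸n]≡+m-+n {m} {n} n≤m = sym (trans (ℤ.m-n≡m⊖n m n) (ℤ.⊖-≥ n≤m))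

+n≡2g+e : ∀ {n} g e → n ≡ 2 * g + e → + n ≡ + 2 ℤ.* + g ℤ.+ + e
+n≡2g+e g e refl = trans (ℤ.pos-+ (2 * g) e) (cong (λ v → v ℤ.+ + e) (ℤ.pos-* 2 g))

n∣a∧a<n⇒a≡0 : ∀ {n a} → n ℕ.∣ a → a < n → a ≡ 0
n∣a∧a<n⇒a≡0 (ℕ.divides zero eq) _ = eq
n∣a∧a<n⇒a≡0 {n} (ℕ.divides (suc q) eq) a<n =
  contradiction (subst (n ≤_) (sym eq) (m≤m+n n (q * n))) (<⇒≱ a<n)

n∣a∧a<2n⇒a≡n : ∀ {n a} → n ℕ.∣ a → 0 < a → a < 2 * n → a ≡ n
n∣a∧a<2n⇒a≡n (ℕ.divides zero refl) () _
n∣a∧a<2n⇒a≡n {n} (ℕ.divides 1 eq) _ _ = trans eq (+-identityʳ n)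
n∣a∧a<2n⇒a≡n {n} (ℕ.divides (suc (suc q)) eq) _ a<2n =
  contradiction (subst (2 * n ≤_) (sym eq) (+-monoʳ-≤ n (+-monoʳ-≤ n z≤n))) (<⇒≱ a<2n)

n∣i∧∣i∣<n⇒i≡0 : ∀ {n i} → + n ∣ i → ∣ i ∣ < n → i ≡ 0ℤ
n∣i∧∣i∣<n⇒i≡0 n∣i ∣i∣<n = ℤ.∣i∣≡0⇒i≡0 (n∣a∧a<n⇒a≡0 (∣⇒∣ᵤ n∣i) ∣i∣<n)

n∣i-j∧∣i-j∣<n⇒i≡j : ∀ {n i j} → + n ∣ i ℤ.- j → ∣ i ℤ.- j ∣ < n → i ≡ j
n∣i-j∧∣i-j∣<n⇒i≡j {i = i} {j} n∣i-j small = ℤ.i-j≡0⇒i≡j i j (n∣i∧∣i∣<n⇒i≡0 n∣i-j small)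

n∣m-m%n : ∀ m n .{{_ : NonZero n}} → + n ∣ + m ℤ.- + (m % n)
n∣m-m%n m n = subst (+ n ∣_) (+[m∸n]≡+m-+n (m%n≤m m n)) (∣ᵤ⇒∣ (ℕ.divides (m / n) m∸m%n≡[m/n]*n))
  where
  m∸m%n≡[m/n]*n : m ∸ m % n ≡ m / n * n
  m∸m%n≡[m/n]*n = trans (cong (_∸ m % n) (m≡m%n+[m/n]*n m n)) (m+n∸m≡n (m % n) _)

[a∸c]/m≡[b∸c]/m⇒∣a-b∣<m : ∀ {a b c} m .{{_ : NonZero m}} → c ≤ a → c ≤ b →
  (a ∸ c) / m ≡ (b ∸ c) / m → ∣ + a ℤ.- + b ∣ < m
[a∸c]/m≡[b∸c]/m⇒∣a-b∣<m {a} {b} {c} m c≤a c≤b eq = begin-strict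
  ∣ + a ℤ.- + b ∣                         ≡⟨ cong ∣_∣ (ℤ.[+m]-[+n]≡m⊖n a b) ⟩
  ∣ a ⊖ b ∣                               ≡⟨ cong ∣_∣ (cong₂ _⊖_ (sym (m+[n∸m]≡n c≤a)) (sym (m+[n∸m]≡n c≤b))) ⟩
  ∣ (c + a′) ⊖ (c + b′) ∣                 ≡⟨ cong ∣_∣ (ℤ.+-cancelˡ-⊖ c a′ b′) ⟩
  ∣ a′ ⊖ b′ ∣                             ≡⟨ cong ∣_∣ (cong₂ _⊖_ (split a′) (trans (split b′) (cong (λ q → q * m + b′ % m) (sym eq)))) ⟩
  ∣ (q * m + a′ % m) ⊖ (q * m + b′ % m) ∣ ≡⟨ cong ∣_∣ (ℤ.+-cancelˡ-⊖ (q * m) (a′ % m) (b′ % m)) ⟩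
  ∣ a′ % m ⊖ b′ % m ∣                     ≤⟨ ℤ.∣m⊝n∣≤m⊔n (a′ % m) (b′ % m) ⟩
  a′ % m ⊔ b′ % m                         <⟨ ⊔-pres-<m (m%n<n a′ m) (m%n<n b′ m) ⟩
  m                                       ∎
  where
  open ≤-Reasoning
  a′ = a ∸ c
  b′ = b ∸ c
  q = a′ / m
  split : ∀ v → v ≡ v / m * m + v % m
  split v = trans (m≡m%n+[m/n]*n v m) (+-comm (v % m) _)

2*∣x∣[n]≤n : ∀ x n .{{_ : NonZero n}} → 2 * ∣ x ∣[ n ] ≤ n
2*∣x∣[n]≤n x n = begin
  2 * (r ⊓ s)     ≡⟨ cong (λ v → r ⊓ s + v) (+-identityʳ (r ⊓ s)) ⟩
  r ⊓ s + r ⊓ s   ≤⟨ +-mono-≤ (m⊓n≤m r s) (m⊓n≤n r s) ⟩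
  r + s           ≤⟨ +-monoʳ-≤ r (m%n≤m (n ∸ r) n) ⟩
  r + (n ∸ r)     ≡⟨ m+[n∸m]≡n (<⇒≤ (m%n<n x n)) ⟩
  n               ∎
  where
  open ≤-Reasoning
  r = x % n
  s = (n ∸ r) % n

∣x∣[n]≡unit*x : ∀ x n .{{_ : NonZero n}} → ∃[ ε ] Unit ε × + n ∣ ε ℤ.* + x ℤ.- + ∣ x ∣[ n ]
∣x∣[n]≡unit*x x n = by-min (⊓-sel r s)
  where
  r = x % n
  s = (n ∸ r) % n
  by-min : r ⊓ s ≡ r ⊎ r ⊓ s ≡ s → ∃[ ε ] Unit ε × + n ∣ ε ℤ.* + x ℤ.- + (r ⊓ s)
  by-min (inj₁ r⊓s≡r) = 1ℤ , inj₁ refl , subst (+ n ∣_) x-r≡1*x-∣x∣ (n∣m-m%n x n)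
    where
    x-r≡1*x-∣x∣ : + x ℤ.- + r ≡ 1ℤ ℤ.* + x ℤ.- + (r ⊓ s)
    x-r≡1*x-∣x∣ = cong₂ ℤ._-_ (sym (ℤ.*-identityˡ (+ x))) (cong +_ (sym r⊓s≡r))
  by-min (inj₂ r⊓s≡s) = -1ℤ , inj₂ refl ,
    subst (+ n ∣_) [n∸r-s]-[x-r]-n≡-x-∣x∣ (∣m∣n⇒∣m-n (∣m∣n⇒∣m-n (n∣m-m%n (n ∸ r) n) (n∣m-m%n x n)) ∣-refl)
    where
    identity : ∀ N R S X → ((N ℤ.- R) ℤ.- S ℤ.- (X ℤ.- R)) ℤ.- N ≡ -1ℤ ℤ.* X ℤ.- S
    identity = ℤ.solve-∀
    [n∸r-s]-[x-r]-n≡-x-∣x∣ : (+ (n ∸ r) ℤ.- + s ℤ.- (+ x ℤ.- + r)) ℤ.- + n ≡ -1ℤ ℤ.* + x ℤ.- + (r ⊓ s)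
    [n∸r-s]-[x-r]-n≡-x-∣x∣ = begin
      (+ (n ∸ r) ℤ.- + s ℤ.- (+ x ℤ.- + r)) ℤ.- + n
        ≡⟨ cong (λ v → (v ℤ.- + s ℤ.- (+ x ℤ.- + r)) ℤ.- + n) (+[m∸n]≡+m-+n (<⇒≤ (m%n<n x n))) ⟩
      ((+ n ℤ.- + r) ℤ.- + s ℤ.- (+ x ℤ.- + r)) ℤ.- + n
        ≡⟨ identity (+ n) (+ r) (+ s) (+ x) ⟩
      -1ℤ ℤ.* + x ℤ.- + s
        ≡⟨ cong (λ v → -1ℤ ℤ.* + x ℤ.- + v) (sym r⊓s≡s) ⟩
      -1ℤ ℤ.* + x ℤ.- + (r ⊓ s) ∎
      where open ≡-Reasoning

record Difference (g k n : ℕ) .{{_ : NonZero n}} (d : ℕ) : Set where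
  field
    x y         : ℕ
    1≤x         : 1 ≤ x
    x<k         : x < k
    1≤y         : 1 ≤ y
    y<k         : y < k
    ∣gx∣≡∣gy∣+d : ∣ g * x ∣[ n ] ≡ ∣ g * y ∣[ n ] + d

range1-bounds : ∀ k → All (λ x → 1 ≤ x × x < k) (range1 k)
range1-bounds zero    = All.[]
range1-bounds (suc k) = All.applyUpTo⁺₁ suc k (λ i<k → s≤s z≤n , s≤s i<k)

range1-unique : ∀ k → Unique (range1 k)
range1-unique k = Unique.drop⁺ 1 (Unique.upTo⁺ k)

inD⇒Difference : ∀ {g k n} .{{_ : NonZero n}} {d} → T (inD g k n d) → Difference g k n d
inD⇒Difference {g} {k} {n} {d} d∈D with All.lookupAny (range1-bounds k) (any⁻ _ (range1 k) d∈D)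
... | (1≤x , x<k) , d∈D[x] with All.lookupAny (range1-bounds k) (any⁻ _ (range1 k) d∈D[x])
... | (1≤y , y<k) , eq = record
  { 1≤x = 1≤x ; x<k = x<k ; 1≤y = 1≤y ; y<k = y<k ; ∣gx∣≡∣gy∣+d = ≡ᵇ⇒≡ _ _ eq }

differences : ∀ g k n .{{_ : NonZero n}} →
  All (λ d → 1 ≤ d × d < k × Difference g k n d) (filter (λ d → T? (inD g k n d)) (range1 k))
differences g k n = All.zipWith (λ { ((1≤d , d<k) , d∈D) → 1≤d , d<k , inD⇒Difference d∈D })
  (All.filter⁺ _ (range1-bounds k) , All.all-filter _ (range1 k))

m<o⇒n<o⇒m+n+2≤2*o : ∀ {m n o} → m < o → n < o → m + n + 2 ≤ 2 * o
m<o⇒n<o⇒m+n+2≤2*o {m} {n} {o} m<o n<o = begin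
  m + n + 2     ≡⟨ trans (+-comm (m + n) 2) (cong suc (sym (+-suc m n))) ⟩
  suc m + suc n ≤⟨ +-mono-≤ m<o n<o ⟩
  o + o         ≡⟨ cong (λ v → o + v) (sym (+-identityʳ o)) ⟩
  2 * o         ∎
  where open ≤-Reasoning

m<n⇒m+2≤2*n : ∀ {m n} → m < n → m + 2 ≤ 2 * n
m<n⇒m+2≤2*n {m} m<n = subst (λ v → v + 2 ≤ _) (+-identityʳ m) (m<o⇒n<o⇒m+n+2≤2*o m<n (≤-<-trans z≤n m<n))

m<n⇒2*m+2≤2*n : ∀ {m n} → m < n → 2 * m + 2 ≤ 2 * n
m<n⇒2*m+2≤2*n {m} {n} m<n = subst (_≤ 2 * n) (*-distribˡ-+ 2 m 1) (*-monoʳ-≤ 2 (subst (_≤ n) (+-comm 1 m) m<n))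

record Witness (g k n d : ℕ) : Set where
  field
    z        : ℤ
    ∣z∣+2≤2k : ∣ z ∣ + 2 ≤ 2 * k
    n∣gz-d   : + n ∣ + g ℤ.* z ℤ.- + d

Difference⇒Witness : ∀ {g k n} .{{_ : NonZero n}} {d} → Difference g k n d → Witness g k n d
Difference⇒Witness {g} {k} {n} {d}
  record { x = x ; y = y ; x<k = x<k ; y<k = y<k ; ∣gx∣≡∣gy∣+d = split }
  with ∣x∣[n]≡unit*x (g * x) n | ∣x∣[n]≡unit*x (g * y) n
... | ε₁ , u₁ , c₁ | ε₂ , u₂ , c₂ = record
  { z        = ε₁ ℤ.* + x ℤ.- ε₂ ℤ.* + y
  ; ∣z∣+2≤2k = ≤-trans (+-monoˡ-≤ 2 ∣z∣≤x+y) (m<o⇒n<o⇒m+n+2≤2*o x<k y<k)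
  ; n∣gz-d   = subst (+ n ∣_) combination (∣m∣n⇒∣m-n c₁ c₂)
  }
  where
  B = ∣ g * y ∣[ n ]
  ∣z∣≤x+y : ∣ ε₁ ℤ.* + x ℤ.- ε₂ ℤ.* + y ∣ ≤ x + y
  ∣z∣≤x+y = ≤-trans (ℤ.∣i-j∣≤∣i∣+∣j∣ (ε₁ ℤ.* + x) (ε₂ ℤ.* + y))
    (≤-reflexive (cong₂ _+_ (∣unit*i∣≡∣i∣ u₁ (+ x)) (∣unit*i∣≡∣i∣ u₂ (+ y))))
  identity : ∀ G X Y E₁ E₂ B D →
    (E₁ ℤ.* (G ℤ.* X) ℤ.- (B ℤ.+ D)) ℤ.- (E₂ ℤ.* (G ℤ.* Y) ℤ.- B) ≡ G ℤ.* (E₁ ℤ.* X ℤ.- E₂ ℤ.* Y) ℤ.- D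
  identity = ℤ.solve-∀
  combination : (ε₁ ℤ.* + (g * x) ℤ.- + ∣ g * x ∣[ n ]) ℤ.- (ε₂ ℤ.* + (g * y) ℤ.- + B)
              ≡ + g ℤ.* (ε₁ ℤ.* + x ℤ.- ε₂ ℤ.* + y) ℤ.- + d
  combination = begin
    (ε₁ ℤ.* + (g * x) ℤ.- + ∣ g * x ∣[ n ]) ℤ.- (ε₂ ℤ.* + (g * y) ℤ.- + B)
      ≡⟨ cong₂ (λ u v → (ε₁ ℤ.* u ℤ.- v) ℤ.- (ε₂ ℤ.* + (g * y) ℤ.- + B))
           (ℤ.pos-* g x) (trans (cong +_ split) (ℤ.pos-+ B d)) ⟩
    (ε₁ ℤ.* (+ g ℤ.* + x) ℤ.- (+ B ℤ.+ + d)) ℤ.- (ε₂ ℤ.* + (g * y) ℤ.- + B)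
      ≡⟨ cong (λ v → (ε₁ ℤ.* (+ g ℤ.* + x) ℤ.- (+ B ℤ.+ + d)) ℤ.- (ε₂ ℤ.* v ℤ.- + B)) (ℤ.pos-* g y) ⟩
    (ε₁ ℤ.* (+ g ℤ.* + x) ℤ.- (+ B ℤ.+ + d)) ℤ.- (ε₂ ℤ.* (+ g ℤ.* + y) ℤ.- + B)
      ≡⟨ identity (+ g) (+ x) (+ y) ε₁ ε₂ (+ B) (+ d) ⟩
    + g ℤ.* (ε₁ ℤ.* + x ℤ.- ε₂ ℤ.* + y) ℤ.- + d ∎
    where open ≡-Reasoning

-- Few residue classes: the cases g ≤ 2k − 2 and 2 ≤ n − 2g ≤ 2k − 2

classes : ℕ → ℕ
classes m = 1 + 2 * (m / 9)

blocks : (m k : ℕ) .{{_ : NonZero m}} → ℕ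
blocks m k = (k ∸ 2) / m + 1

tn≤mz+c⇒9t≤m : ∀ {m z c n} k t → 18 * k < n → t * n ≤ m * z + c → z + 2 ≤ 2 * k → c + 2 ≤ 2 * k →
  9 * t ≤ m
tn≤mz+c⇒9t≤m {m} {z} {c} {n} k t 18k<n tn≤mz+c z+2≤2k c+2≤2k = ≮⇒≥ λ m<9t → <⇒≱ (mz+c<tn m<9t) tn≤mz+c
  where
  open ≤-Reasoning
  mz+c<tn : m < 9 * t → m * z + c < t * n
  mz+c<tn m<9t = begin-strict
    m * z + c            <⟨ +-mono-≤-< (*-monoʳ-≤ m (≤-trans (m≤m+n z 2) z+2≤2k)) (<-≤-trans (m<m+n c z<s) c+2≤2k) ⟩
    m * (2 * k) + 2 * k  ≡⟨ ℕ.solve (m ∷ k ∷ []) ⟩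
    suc m * (2 * k)      ≤⟨ *-monoˡ-≤ (2 * k) m<9t ⟩
    9 * t * (2 * k)      ≡⟨ ℕ.solve (t ∷ k ∷ []) ⟩
    t * (18 * k)         ≤⟨ *-monoʳ-≤ t (<⇒≤ 18k<n) ⟩
    t * n                ∎

3*[1+2J]*[B+1]<2k : ∀ {m k′} J B → 2 ≤ m → m ≤ 2 * k′ + 2 → J * 9 ≤ m → B * m ≤ k′ →
  3 * ((1 + 2 * J) * (B + 1)) < 2 * suc (suc k′)
3*[1+2J]*[B+1]<2k {m} {k′} zero B 2≤m _ _ Bm≤k′ = begin-strict
  3 * ((1 + 2 * 0) * (B + 1)) ≡⟨ ℕ.solve (B ∷ []) ⟩
  B + B + B + 3               ≤⟨ +-monoˡ-≤ 3 (+-mono-≤ 2B≤k′ (≤-trans (m≤m+n B B) 2B≤k′)) ⟩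
  k′ + k′ + 3                 <⟨ ≤-reflexive (ℕ.solve (k′ ∷ [])) ⟩
  2 * suc (suc k′)            ∎
  where
  open ≤-Reasoning
  2B≤k′ : B + B ≤ k′
  2B≤k′ = ≤-trans (≤-reflexive (ℕ.solve (B ∷ []))) (≤-trans (*-monoʳ-≤ B 2≤m) Bm≤k′)
3*[1+2J]*[B+1]<2k {m} {k′} (suc J) zero _ m≤2k′+2 J9≤m _ = *-cancelˡ-< 3 _ _ (begin-strict
  3 * (3 * ((1 + 2 * suc J) * (0 + 1))) ≡⟨ ℕ.solve (J ∷ []) ⟩
  2 * (suc J * 9) + 9                   ≤⟨ +-mono-≤ (*-monoʳ-≤ 2 J9≤m) (≤-trans (m≤m+n 9 (J * 9)) J9≤m) ⟩
  2 * m + m                             ≡⟨ ℕ.solve (m ∷ []) ⟩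
  3 * m                                 ≤⟨ *-monoʳ-≤ 3 m≤2k′+2 ⟩
  3 * (2 * k′ + 2)                      <⟨ *-monoʳ-< 3 2k′+2<2k ⟩
  3 * (2 * suc (suc k′))                ∎)
  where
  open ≤-Reasoning
  2k′+2<2k : 2 * k′ + 2 < 2 * suc (suc k′)
  2k′+2<2k = ≤-trans (m≤m+n (suc (2 * k′ + 2)) 1) (≤-reflexive (ℕ.solve (k′ ∷ [])))
3*[1+2J]*[B+1]<2k {m} {k′} (suc J) (suc B) _ _ J9≤m Bm≤k′ = *-cancelˡ-< 3 _ _ (begin-strict
  3 * (3 * ((1 + 2 * suc J) * (suc B + 1))) ≡⟨ ℕ.solve (J ∷ B ∷ []) ⟩
  (2 * (suc J * 9) + 9) * (suc B + 1)       ≤⟨ *-monoˡ-≤ (suc B + 1) (+-monoˡ-≤ 9 (*-monoʳ-≤ 2 J9≤m)) ⟩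
  (2 * m + 9) * (suc B + 1)                 ≡⟨ ℕ.solve (m ∷ B ∷ []) ⟩
  2 * (suc B * m) + 2 * m + 9 * suc B + 9   ≤⟨ +-monoˡ-≤ 9 (+-mono-≤ (+-mono-≤ (*-monoʳ-≤ 2 Bm≤k′) (*-monoʳ-≤ 2 m≤k′)) 9B≤k′) ⟩
  2 * k′ + 2 * k′ + k′ + 9                  <⟨ ≤-trans (m≤m+n _ (k′ + 2)) (≤-reflexive (ℕ.solve (k′ ∷ []))) ⟩
  3 * (2 * suc (suc k′))                    ∎)
  where
  open ≤-Reasoning
  m≤k′ : m ≤ k′
  m≤k′ = ≤-trans (m≤m+n m (B * m)) Bm≤k′
  9B≤k′ : 9 * suc B ≤ k′
  9B≤k′ = ≤-trans (≤-reflexive (*-comm 9 (suc B)))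
    (≤-trans (*-monoʳ-≤ (suc B) (≤-trans (m≤m+n 9 (J * 9)) J9≤m)) Bm≤k′)

3*classes*blocks<2k : ∀ {m k} .{{_ : NonZero m}} → 2 ≤ m → m + 2 ≤ 2 * k → 3 * (classes m * blocks m k) < 2 * k
3*classes*blocks<2k {m} {zero} _ m+2≤0 = contradiction (≤-trans (m≤n+m 2 m) m+2≤0) λ ()
3*classes*blocks<2k {m} {1} 2≤m m+2≤2 = contradiction (≤-trans 2≤m (+-cancelʳ-≤ 2 m 0 m+2≤2)) λ ()
3*classes*blocks<2k {m} {suc (suc k′)} 2≤m m+2≤2k =
  3*[1+2J]*[B+1]<2k (m / 9) (k′ / m) 2≤m m≤2k′+2 (m/n*n≤m m 9) (m/n*n≤m k′ m)
  where
  m≤2k′+2 : m ≤ 2 * k′ + 2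
  m≤2k′+2 = +-cancelʳ-≤ 2 m (2 * k′ + 2) (≤-trans m+2≤2k (≤-reflexive (ℕ.solve (k′ ∷ []))))

∣i∣≤j⇒+∣i+j∣≡i+j : ∀ {j} i → ∣ i ∣ ≤ j → + ∣ i ℤ.+ + j ∣ ≡ i ℤ.+ + j
∣i∣≤j⇒+∣i+j∣≡i+j (+ _)      _     = refl
∣i∣≤j⇒+∣i+j∣≡i+j -[1+ _ ] i<j = trans (cong (λ i → + ∣ i ∣) (ℤ.⊖-≥ i<j)) (sym (ℤ.⊖-≥ i<j))

module _ {m k r : ℕ} .{{_ : NonZero m}} {P : ℕ → Set}
  (class : ∀ {d} → P d → Fin r)
  (same-class : ∀ {d₁ d₂} (p₁ : P d₁) (p₂ : P d₂) → class p₁ ≡ class p₂ → + m ∣ + d₁ ℤ.- + d₂)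
  where

  length≤-by-residue : ∀ {L} → Unique L → All (λ d → 1 ≤ d × d < k × P d) L → length L ≤ r * blocks m k
  length≤-by-residue = length≤-by-code code code-injective
    where
    block< : ∀ {d} → d < k → (d ∸ 1) / m < blocks m k
    block< {d} d<k = subst ((d ∸ 1) / m <_) (+-comm 1 ((k ∸ 2) / m)) (s≤s (/-monoˡ-≤ m (∸-monoˡ-≤ 2 d<k)))
    code : ∀ {d} → 1 ≤ d × d < k × P d → Fin (r * blocks m k)
    code (_ , d<k , p) = combine (class p) (fromℕ< (block< d<k))
    code-injective : ∀ {d₁ d₂} (p₁ : 1 ≤ d₁ × d₁ < k × P d₁) (p₂ : 1 ≤ d₂ × d₂ < k × P d₂) →
      code p₁ ≡ code p₂ → d₁ ≡ d₂
    code-injective (1≤d₁ , d₁<k , p₁) (1≤d₂ , d₂<k , p₂) eq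
      with combine-injective (class p₁) _ (class p₂) _ eq
    ... | same , same-block = ℤ.+-injective (n∣i-j∧∣i-j∣<n⇒i≡j (same-class p₁ p₂ same)
      ([a∸c]/m≡[b∸c]/m⇒∣a-b∣<m m 1≤d₁ 1≤d₂ (fromℕ<-injective _ _ (block< d₁<k) (block< d₂<k) same-block)))

few-in-residue-classes : ∀ {m k L} .{{_ : NonZero m}} (a : ℤ) → 2 ≤ m → m + 2 ≤ 2 * k → Unique L →
  All (λ d → 1 ≤ d × d < k × ∃[ t ] 9 * ∣ t ∣ ≤ m × + m ∣ + d ℤ.- a ℤ.* t) L → 3 * length L < 2 * k
few-in-residue-classes {m} {k} a 2≤m m+2≤2k u ds =
  ≤-<-trans (*-monoʳ-≤ 3 (length≤-by-residue {k = k} class same-class u ds)) (3*classes*blocks<2k {k = k} 2≤m m+2≤2k)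
  where
  J = m / 9
  ∣t∣≤J : ∀ {t} → 9 * ∣ t ∣ ≤ m → ∣ t ∣ ≤ J
  ∣t∣≤J {t} 9t≤m = subst (_≤ J) (m*n/n≡m ∣ t ∣ 9) (/-monoˡ-≤ 9 (≤-trans (≤-reflexive (*-comm ∣ t ∣ 9)) 9t≤m))
  class : ∀ {d} → (∃[ t ] 9 * ∣ t ∣ ≤ m × + m ∣ + d ℤ.- a ℤ.* t) → Fin (classes m)
  class (t , 9t≤m , _) = fromℕ< (s≤s (≤-trans (ℤ.∣i+j∣≤∣i∣+∣j∣ t (+ J))
    (≤-trans (+-monoˡ-≤ J (∣t∣≤J {t} 9t≤m)) (≤-reflexive (cong (λ v → J + v) (sym (+-identityʳ J)))))))
  same-class : ∀ {d₁ d₂} (p₁ : ∃[ t ] 9 * ∣ t ∣ ≤ m × + m ∣ + d₁ ℤ.- a ℤ.* t)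
    (p₂ : ∃[ t ] 9 * ∣ t ∣ ≤ m × + m ∣ + d₂ ℤ.- a ℤ.* t) → class p₁ ≡ class p₂ → + m ∣ + d₁ ℤ.- + d₂
  same-class {d₁} {d₂} (t₁ , 9t₁≤m , c₁) (t₂ , 9t₂≤m , c₂) eq
    with ∙-cancelʳ (+ J) t₁ t₂ (trans (sym (∣i∣≤j⇒+∣i+j∣≡i+j t₁ (∣t∣≤J {t₁} 9t₁≤m)))
           (trans (cong +_ (fromℕ<-injective _ _ _ _ eq)) (∣i∣≤j⇒+∣i+j∣≡i+j t₂ (∣t∣≤J {t₂} 9t₂≤m))))
  ... | refl = subst (+ m ∣_) (identity (+ d₁) (+ d₂) (a ℤ.* t₁)) (∣m∣n⇒∣m-n c₁ c₂)
    where
    identity : ∀ D₁ D₂ X → (D₁ ℤ.- X) ℤ.- (D₂ ℤ.- X) ≡ D₁ ℤ.- D₂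
    identity = ℤ.solve-∀

Witness⇒residue-mod-g : ∀ {g k n d} → 18 * k < n → d < k → Witness g k n d →
  ∃[ t ] 9 * ∣ t ∣ ≤ g × + g ∣ + d ℤ.- (ℤ.- + n) ℤ.* t
Witness⇒residue-mod-g {g} {k} {n} {d} 18k<n d<k
  record { z = z ; ∣z∣+2≤2k = ∣z∣+2≤2k ; n∣gz-d = divides q gz-d≡qn } =
  q , tn≤mz+c⇒9t≤m k ∣ q ∣ 18k<n ∣q∣n≤g∣z∣+d ∣z∣+2≤2k (m<n⇒m+2≤2*n d<k) ,
  divides z (d+nq≡zg (+ g) (+ n) z q (+ d) gz-d≡qn)
  where
  d+nq≡zg : ∀ G N Z Q D → G ℤ.* Z ℤ.- D ≡ Q ℤ.* N → D ℤ.- (ℤ.- N) ℤ.* Q ≡ Z ℤ.* G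
  d+nq≡zg G N Z Q D eq = begin
    D ℤ.- (ℤ.- N) ℤ.* Q      ≡⟨ ℤ.solve (D ∷ N ∷ Q ∷ []) ⟩
    D ℤ.+ Q ℤ.* N            ≡⟨ cong (λ v → D ℤ.+ v) eq ⟨
    D ℤ.+ (G ℤ.* Z ℤ.- D)    ≡⟨ ℤ.solve (D ∷ G ∷ Z ∷ []) ⟩
    Z ℤ.* G                  ∎
    where open ≡-Reasoning
  ∣q∣n≤g∣z∣+d : ∣ q ∣ * n ≤ g * ∣ z ∣ + d
  ∣q∣n≤g∣z∣+d = begin
    ∣ q ∣ * n                ≡⟨ ℤ.∣i*j∣≡∣i∣*∣j∣ q (+ n) ⟨
    ∣ q ℤ.* + n ∣            ≡⟨ cong ∣_∣ gz-d≡qn ⟨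
    ∣ + g ℤ.* z ℤ.- + d ∣    ≤⟨ ℤ.∣i-j∣≤∣i∣+∣j∣ (+ g ℤ.* z) (+ d) ⟩
    ∣ + g ℤ.* z ∣ + d        ≡⟨ cong (λ v → v + d) (ℤ.∣i*j∣≡∣i∣*∣j∣ (+ g) z) ⟩
    g * ∣ z ∣ + d            ∎
    where open ≤-Reasoning

Witness⇒residue-mod-e : ∀ {g e k n d} → n ≡ 2 * g + e → 18 * k < n → d < k → Witness g k n d →
  ∃[ t ] 9 * ∣ t ∣ ≤ e × + e ∣ + d ℤ.- + g ℤ.* t
Witness⇒residue-mod-e {g} {e} {k} {n} {d} n≡2g+e 18k<n d<k
  record { z = z ; ∣z∣+2≤2k = ∣z∣+2≤2k ; n∣gz-d = divides q gz-d≡qn } =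
  t , tn≤mz+c⇒9t≤m k ∣ t ∣ 18k<n ∣t∣n≤e∣z∣+2d ∣z∣+2≤2k (m<n⇒2*m+2≤2*n d<k) ,
  divides (ℤ.- q) (d-gt≡-qe (+ g) (+ e) z q (+ d) gz-d≡q[2g+e])
  where
  t = z ℤ.- + 2 ℤ.* q
  gz-d≡q[2g+e] : + g ℤ.* z ℤ.- + d ≡ q ℤ.* (+ 2 ℤ.* + g ℤ.+ + e)
  gz-d≡q[2g+e] = trans gz-d≡qn (cong (λ v → q ℤ.* v) (+n≡2g+e g e n≡2g+e))
  d-gt≡-qe : ∀ G E Z Q D → G ℤ.* Z ℤ.- D ≡ Q ℤ.* (+ 2 ℤ.* G ℤ.+ E) →
    D ℤ.- G ℤ.* (Z ℤ.- + 2 ℤ.* Q) ≡ ℤ.- Q ℤ.* E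
  d-gt≡-qe G E Z Q D eq = begin
    D ℤ.- G ℤ.* (Z ℤ.- + 2 ℤ.* Q)               ≡⟨ ℤ.solve (D ∷ G ∷ Z ∷ Q ∷ []) ⟩
    + 2 ℤ.* G ℤ.* Q ℤ.- (G ℤ.* Z ℤ.- D)         ≡⟨ cong (λ v → + 2 ℤ.* G ℤ.* Q ℤ.- v) eq ⟩
    + 2 ℤ.* G ℤ.* Q ℤ.- Q ℤ.* (+ 2 ℤ.* G ℤ.+ E) ≡⟨ ℤ.solve (G ∷ Q ∷ E ∷ []) ⟩
    ℤ.- Q ℤ.* E                                 ∎
    where open ≡-Reasoning
  tn≡ez+2d : ∀ G E Z Q D → G ℤ.* Z ℤ.- D ≡ Q ℤ.* (+ 2 ℤ.* G ℤ.+ E) →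
    (Z ℤ.- + 2 ℤ.* Q) ℤ.* (+ 2 ℤ.* G ℤ.+ E) ≡ E ℤ.* Z ℤ.+ + 2 ℤ.* D
  tn≡ez+2d G E Z Q D eq = begin
    (Z ℤ.- + 2 ℤ.* Q) ℤ.* (+ 2 ℤ.* G ℤ.+ E)                         ≡⟨ ℤ.solve (Z ∷ Q ∷ G ∷ E ∷ []) ⟩
    Z ℤ.* (+ 2 ℤ.* G ℤ.+ E) ℤ.- + 2 ℤ.* (Q ℤ.* (+ 2 ℤ.* G ℤ.+ E)) ≡⟨ cong (λ v → Z ℤ.* (+ 2 ℤ.* G ℤ.+ E) ℤ.- + 2 ℤ.* v) eq ⟨
    Z ℤ.* (+ 2 ℤ.* G ℤ.+ E) ℤ.- + 2 ℤ.* (G ℤ.* Z ℤ.- D)             ≡⟨ ℤ.solve (Z ∷ G ∷ E ∷ D ∷ []) ⟩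
    E ℤ.* Z ℤ.+ + 2 ℤ.* D                                           ∎
    where open ≡-Reasoning
  ∣t∣n≤e∣z∣+2d : ∣ t ∣ * n ≤ e * ∣ z ∣ + 2 * d
  ∣t∣n≤e∣z∣+2d = begin
    ∣ t ∣ * n                         ≡⟨ ℤ.∣i*j∣≡∣i∣*∣j∣ t (+ n) ⟨
    ∣ t ℤ.* + n ∣                     ≡⟨ cong (λ v → ∣ t ℤ.* v ∣) (+n≡2g+e g e n≡2g+e) ⟩
    ∣ t ℤ.* (+ 2 ℤ.* + g ℤ.+ + e) ∣   ≡⟨ cong ∣_∣ (tn≡ez+2d (+ g) (+ e) z q (+ d) gz-d≡q[2g+e]) ⟩
    ∣ + e ℤ.* z ℤ.+ + 2 ℤ.* + d ∣     ≤⟨ ℤ.∣i+j∣≤∣i∣+∣j∣ (+ e ℤ.* z) (+ 2 ℤ.* + d) ⟩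
    ∣ + e ℤ.* z ∣ + ∣ + 2 ℤ.* + d ∣   ≡⟨ cong₂ _+_ (ℤ.∣i*j∣≡∣i∣*∣j∣ (+ e) z) (ℤ.∣i*j∣≡∣i∣*∣j∣ (+ 2) (+ d)) ⟩
    e * ∣ z ∣ + 2 * d                 ∎
    where open ≤-Reasoning

-- The cases n = 2g and n = 2g + 1

no-Witness-if-n≡2g : ∀ {g k n d} → n ≡ 2 * g → 1 ≤ d → 2 * d < n → ¬ Witness g k n d
no-Witness-if-n≡2g {g} {k} {n} {d@(suc _)} n≡2g (s≤s z≤n) 2d<n record { z = z ; n∣gz-d = n∣gz-d } =
  contradiction (ℤ.+-injective (n∣i∧∣i∣<n⇒i≡0 n∣2d 2d<n)) λ ()
  where
  identity : ∀ G Z D → Z ℤ.* (+ 2 ℤ.* G) ℤ.- + 2 ℤ.* (G ℤ.* Z ℤ.- D) ≡ + 2 ℤ.* D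
  identity = ℤ.solve-∀
  n∣2d : + n ∣ + (2 * d)
  n∣2d = subst (+ n ∣_)
    (begin
      z ℤ.* + n ℤ.- + 2 ℤ.* (+ g ℤ.* z ℤ.- + d)         ≡⟨ cong (λ v → z ℤ.* v ℤ.- + 2 ℤ.* (+ g ℤ.* z ℤ.- + d)) (trans (cong +_ n≡2g) (ℤ.pos-* 2 g)) ⟩
      z ℤ.* (+ 2 ℤ.* + g) ℤ.- + 2 ℤ.* (+ g ℤ.* z ℤ.- + d) ≡⟨ identity (+ g) z (+ d) ⟩
      + 2 ℤ.* + d                                        ≡⟨ ℤ.pos-* 2 d ⟨
      + (2 * d)                                          ∎)
    (∣m∣n⇒∣m-n (∣n⇒∣m*n z (∣-refl {+ n})) (∣n⇒∣m*n (+ 2) n∣gz-d))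
    where open ≡-Reasoning

n∣εx+2∣gx∣[n] : ∀ {g n} x .{{_ : NonZero n}} → n ≡ 2 * g + 1 →
  ∃[ ε ] Unit ε × + n ∣ ε ℤ.* + x ℤ.+ + 2 ℤ.* + ∣ g * x ∣[ n ]
n∣εx+2∣gx∣[n] {g} {n} x n≡2g+1 with ∣x∣[n]≡unit*x (g * x) n
... | ε , u , c = ε , u , subst (+ n ∣_) εxn-2[εgx-A]≡εx+2A
  (∣m∣n⇒∣m-n (∣n⇒∣m*n (ε ℤ.* + x) (∣-refl {+ n})) (∣n⇒∣m*n (+ 2) c))
  where
  A = ∣ g * x ∣[ n ]
  identity : ∀ G X E A → E ℤ.* X ℤ.* (+ 2 ℤ.* G ℤ.+ 1ℤ) ℤ.- + 2 ℤ.* (E ℤ.* (G ℤ.* X) ℤ.- A) ≡ E ℤ.* X ℤ.+ + 2 ℤ.* A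
  identity = ℤ.solve-∀
  εxn-2[εgx-A]≡εx+2A : ε ℤ.* + x ℤ.* + n ℤ.- + 2 ℤ.* (ε ℤ.* + (g * x) ℤ.- + A) ≡ ε ℤ.* + x ℤ.+ + 2 ℤ.* + A
  εxn-2[εgx-A]≡εx+2A = begin
    ε ℤ.* + x ℤ.* + n ℤ.- + 2 ℤ.* (ε ℤ.* + (g * x) ℤ.- + A)
      ≡⟨ cong₂ (λ u v → ε ℤ.* + x ℤ.* u ℤ.- + 2 ℤ.* (ε ℤ.* v ℤ.- + A)) (+n≡2g+e g 1 n≡2g+1) (ℤ.pos-* g x) ⟩
    ε ℤ.* + x ℤ.* (+ 2 ℤ.* + g ℤ.+ 1ℤ) ℤ.- + 2 ℤ.* (ε ℤ.* (+ g ℤ.* + x) ℤ.- + A)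
      ≡⟨ identity (+ g) (+ x) ε (+ A) ⟩
    ε ℤ.* + x ℤ.+ + 2 ℤ.* + A ∎
    where open ≡-Reasoning

2∣gx∣[n]+x≡n⊎2∣gx∣[n]≡x : ∀ {g n x} .{{_ : NonZero n}} → n ≡ 2 * g + 1 → 1 ≤ x → x < n →
  2 * ∣ g * x ∣[ n ] + x ≡ n ⊎ 2 * ∣ g * x ∣[ n ] ≡ x
2∣gx∣[n]+x≡n⊎2∣gx∣[n]≡x {g} {n} {x} n≡2g+1 1≤x x<n = by-sign (n∣εx+2∣gx∣[n] {g} x n≡2g+1)
  where
  A = ∣ g * x ∣[ n ]
  2A+a<2n : ∀ {a} → a < n → 2 * A + a < 2 * n
  2A+a<2n a<n = <-≤-trans (+-mono-≤-< (2*∣x∣[n]≤n (g * x) n) a<n) (≤-reflexive (cong (λ v → n + v) (sym (+-identityʳ n))))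
  by-sign : (∃[ ε ] Unit ε × + n ∣ ε ℤ.* + x ℤ.+ + 2 ℤ.* + A) → 2 * A + x ≡ n ⊎ 2 * A ≡ x
  by-sign (_ , inj₁ refl , n∣εx+2A) = inj₁ (n∣a∧a<2n⇒a≡n (∣⇒∣ᵤ (subst (+ n ∣_) 1x+2A≡2A+x n∣εx+2A))
    (≤-trans 1≤x (m≤n+m x (2 * A))) (2A+a<2n x<n))
    where
    1x+2A≡2A+x : 1ℤ ℤ.* + x ℤ.+ + 2 ℤ.* + A ≡ + (2 * A + x)
    1x+2A≡2A+x = trans (ℤ.+-comm (1ℤ ℤ.* + x) (+ 2 ℤ.* + A))
      (sym (trans (ℤ.pos-+ (2 * A) x) (cong₂ ℤ._+_ (ℤ.pos-* 2 A) (sym (ℤ.*-identityˡ (+ x))))))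
  by-sign (_ , inj₂ refl , n∣εx+2A) = inj₂ (+-cancelʳ-≡ (n ∸ x) (2 * A) x (trans 2A+[n∸x]≡n (sym (m+[n∸m]≡n (<⇒≤ x<n)))))
    where
    identity′ : ∀ X A N → -1ℤ ℤ.* X ℤ.+ + 2 ℤ.* A ℤ.+ N ≡ + 2 ℤ.* A ℤ.+ (N ℤ.- X)
    identity′ = ℤ.solve-∀
    -x+2A+n≡2A+[n∸x] : -1ℤ ℤ.* + x ℤ.+ + 2 ℤ.* + A ℤ.+ + n ≡ + (2 * A + (n ∸ x))
    -x+2A+n≡2A+[n∸x] = begin
      -1ℤ ℤ.* + x ℤ.+ + 2 ℤ.* + A ℤ.+ + n ≡⟨ identity′ (+ x) (+ A) (+ n) ⟩
      + 2 ℤ.* + A ℤ.+ (+ n ℤ.- + x)       ≡⟨ cong₂ ℤ._+_ (ℤ.pos-* 2 A) (+[m∸n]≡+m-+n (<⇒≤ x<n)) ⟨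
      + (2 * A) ℤ.+ + (n ∸ x)             ≡⟨ ℤ.pos-+ (2 * A) (n ∸ x) ⟨
      + (2 * A + (n ∸ x))                 ∎
      where open ≡-Reasoning
    2A+[n∸x]≡n : 2 * A + (n ∸ x) ≡ n
    2A+[n∸x]≡n = n∣a∧a<2n⇒a≡n (∣⇒∣ᵤ (subst (+ n ∣_) -x+2A+n≡2A+[n∸x] (∣m∣n⇒∣m+n n∣εx+2A ∣-refl)))
      (≤-trans (m<n⇒0<n∸m x<n) (m≤n+m (n ∸ x) (2 * A))) (2A+a<2n (∸-monoʳ-< {n} 1≤x (<⇒≤ x<n)))

Difference⇒2d+2≤k : ∀ {g k n d} .{{_ : NonZero n}} → n ≡ 2 * g + 1 → 4 * k ≤ n → d < k →
  Difference g k n d → 2 * d + 2 ≤ k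
Difference⇒2d+2≤k {g} {k} {n} {d} n≡2g+1 4k≤n d<k
  record { x = x ; y = y ; 1≤x = 1≤x ; x<k = x<k ; 1≤y = 1≤y ; y<k = y<k ; ∣gx∣≡∣gy∣+d = split } =
  by-halves (2∣gx∣[n]+x≡n⊎2∣gx∣[n]≡x {g} n≡2g+1 1≤x (x<n x<k)) (2∣gx∣[n]+x≡n⊎2∣gx∣[n]≡x {g} n≡2g+1 1≤y (x<n y<k))
  where
  open ≤-Reasoning
  A = ∣ g * x ∣[ n ]
  B = ∣ g * y ∣[ n ]
  x<n : ∀ {x} → x < k → x < n
  x<n x<k = <-≤-trans x<k (≤-trans (m≤m+n k (3 * k)) 4k≤n)
  2A≡2B+2d : 2 * A ≡ 2 * B + 2 * d
  2A≡2B+2d = trans (cong (2 *_) split) (*-distribˡ-+ 2 B d)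
  2d+x+y<4k : 2 * d + x + y < 4 * k
  2d+x+y<4k = begin-strict
    2 * d + x + y           <⟨ m<m+n (2 * d + x + y) {4} z<s ⟩
    2 * d + x + y + 4       ≡⟨ ℕ.solve (d ∷ x ∷ y ∷ []) ⟩
    2 * d + 2 + (x + y + 2) ≤⟨ +-mono-≤ (m<n⇒2*m+2≤2*n d<k) (m<o⇒n<o⇒m+n+2≤2*o x<k y<k) ⟩
    2 * k + 2 * k           ≡⟨ ℕ.solve (k ∷ []) ⟩
    4 * k                   ∎
  close : ∀ {u v} → 2 * d + u ≡ v → 1 ≤ u → v < k → 2 * d + 2 ≤ k
  close {u} {v} 2d+u≡v 1≤u v<k = begin
    2 * d + 2       ≤⟨ +-monoʳ-≤ (2 * d) (s≤s 1≤u) ⟩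
    2 * d + suc u   ≡⟨ trans (+-suc (2 * d) u) (cong suc 2d+u≡v) ⟩
    suc v           ≤⟨ v<k ⟩
    k               ∎
  by-halves : 2 * A + x ≡ n ⊎ 2 * A ≡ x → 2 * B + y ≡ n ⊎ 2 * B ≡ y → 2 * d + 2 ≤ k
  by-halves (inj₁ 2A+x≡n) (inj₁ 2B+y≡n) = close (+-cancelˡ-≡ (2 * B) (2 * d + x) y (begin-equality
    2 * B + (2 * d + x) ≡⟨ +-assoc (2 * B) (2 * d) x ⟨
    2 * B + 2 * d + x   ≡⟨ cong (λ v → v + x) 2A≡2B+2d ⟨
    2 * A + x           ≡⟨ trans 2A+x≡n (sym 2B+y≡n) ⟩
    2 * B + y           ∎)) 1≤x y<k
  by-halves (inj₂ 2A≡x) (inj₂ 2B≡y) = close (begin-equality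
    2 * d + y       ≡⟨ cong (λ v → 2 * d + v) 2B≡y ⟨
    2 * d + 2 * B   ≡⟨ trans (+-comm (2 * d) (2 * B)) (sym 2A≡2B+2d) ⟩
    2 * A           ≡⟨ 2A≡x ⟩
    x               ∎) 1≤y x<k
  by-halves (inj₁ 2A+x≡n) (inj₂ 2B≡y) = contradiction 4k≤n (<⇒≱ (begin-strict
    n                 ≡⟨ 2A+x≡n ⟨
    2 * A + x         ≡⟨ cong (λ v → v + x) 2A≡2B+2d ⟩
    2 * B + 2 * d + x ≡⟨ cong (λ v → v + 2 * d + x) 2B≡y ⟩
    y + 2 * d + x     ≡⟨ ℕ.solve (y ∷ d ∷ x ∷ []) ⟩
    2 * d + x + y     <⟨ 2d+x+y<4k ⟩
    4 * k             ∎))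
  by-halves (inj₂ 2A≡x) (inj₁ 2B+y≡n) = contradiction 4k≤n (<⇒≱ (begin-strict
    n                 ≡⟨ 2B+y≡n ⟨
    2 * B + y         ≤⟨ +-monoˡ-≤ y (m≤n+m (2 * B) (2 * d)) ⟩
    2 * d + 2 * B + y ≡⟨ cong (λ v → v + y) (trans (+-comm (2 * d) (2 * B)) (trans (sym 2A≡2B+2d) 2A≡x)) ⟩
    x + y             ≤⟨ m≤n+m (x + y) (2 * d) ⟩
    2 * d + (x + y)   ≡⟨ +-assoc (2 * d) x y ⟨
    2 * d + x + y     <⟨ 2d+x+y<4k ⟩
    4 * k             ∎))

few-if-2d+2≤k : ∀ {k L} → 1 ≤ k → Unique L → All (λ d → 1 ≤ d × 2 * d + 2 ≤ k) L → 3 * length L < 2 * k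
few-if-2d+2≤k {k} 1≤k u ds = ≤-<-trans (*-monoʳ-≤ 3 (length≤-by-code code code-injective u ds)) (begin-strict
  3 * q         ≤⟨ *-monoˡ-≤ q {3} {4} (n≤1+n 3) ⟩
  4 * q         ≡⟨ trans (*-assoc 2 2 q) (cong (2 *_) (*-comm 2 q)) ⟩
  2 * (q * 2)   ≤⟨ *-monoʳ-≤ 2 (m/n*n≤m (k ∸ 2) 2) ⟩
  2 * (k ∸ 2)   <⟨ *-monoʳ-< 2 (≤-<-trans (∸-monoʳ-≤ k (n≤1+n 1)) (∸-monoʳ-< z<s 1≤k)) ⟩
  2 * k         ∎)
  where
  open ≤-Reasoning
  q = (k ∸ 2) / 2
  d∸1<q : ∀ {d} → 1 ≤ d → 2 * d + 2 ≤ k → d ∸ 1 < q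
  d∸1<q {suc d′} _ 2d+2≤k = subst (_≤ q) (m*n/n≡m (suc d′) 2)
    (/-monoˡ-≤ 2 (subst (_≤ k ∸ 2) (*-comm 2 (suc d′)) (m+n≤o⇒m≤o∸n (2 * suc d′) 2d+2≤k)))
  code : ∀ {d} → 1 ≤ d × 2 * d + 2 ≤ k → Fin q
  code (1≤d , 2d+2≤k) = fromℕ< (d∸1<q 1≤d 2d+2≤k)
  code-injective : ∀ {d₁ d₂} (p₁ : 1 ≤ d₁ × 2 * d₁ + 2 ≤ k) (p₂ : 1 ≤ d₂ × 2 * d₂ + 2 ≤ k) →
    code p₁ ≡ code p₂ → d₁ ≡ d₂
  code-injective {suc _} {suc _} (1≤d₁ , h₁) (1≤d₂ , h₂) eq =
    cong suc (fromℕ<-injective _ _ (d∸1<q 1≤d₁ h₁) (d∸1<q 1≤d₂ h₂) eq)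

-- The case g > 2k − 2 and n − 2g > 2k − 2

module _ {g e k n : ℕ} .{{_ : NonZero n}} (n≡2g+e : n ≡ 2 * g + e) (2k<g+2 : 2 * k < g + 2) (2k<e+2 : 2 * k < e + 2)
  where

  n∣gδ-v⇒v≡0 : ∀ δ v → ∣ δ ∣ ≤ 2 → ∣ v ∣ + 2 ≤ 2 * k → + n ∣ + g ℤ.* δ ℤ.- v → v ≡ 0ℤ
  n∣gδ-v⇒v≡0 δ v ∣δ∣≤2 ∣v∣+2≤2k n∣gδ-v =
    trans (sym gδ≡v) (trans (cong (λ w → + g ℤ.* w) δ≡0) (ℤ.*-zeroʳ (+ g)))
    where
    ∣v∣<g : ∣ v ∣ < g
    ∣v∣<g = +-cancelʳ-< 2 ∣ v ∣ g (≤-<-trans ∣v∣+2≤2k 2k<g+2)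
    small : ∣ + g ℤ.* δ ℤ.- v ∣ < n
    small = +-cancelʳ-< 2 _ n (begin-strict
      ∣ + g ℤ.* δ ℤ.- v ∣ + 2       ≤⟨ +-monoˡ-≤ 2 (ℤ.∣i-j∣≤∣i∣+∣j∣ (+ g ℤ.* δ) v) ⟩
      ∣ + g ℤ.* δ ∣ + ∣ v ∣ + 2     ≡⟨ cong (λ w → w + ∣ v ∣ + 2) (ℤ.∣i*j∣≡∣i∣*∣j∣ (+ g) δ) ⟩
      g * ∣ δ ∣ + ∣ v ∣ + 2         ≤⟨ +-monoˡ-≤ 2 (+-monoˡ-≤ ∣ v ∣ (*-monoʳ-≤ g ∣δ∣≤2)) ⟩
      g * 2 + ∣ v ∣ + 2             ≡⟨ +-assoc (g * 2) ∣ v ∣ 2 ⟩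
      g * 2 + (∣ v ∣ + 2)           ≤⟨ +-monoʳ-≤ (g * 2) ∣v∣+2≤2k ⟩
      g * 2 + 2 * k                 <⟨ +-monoʳ-< (g * 2) 2k<e+2 ⟩
      g * 2 + (e + 2)               ≡⟨ ℕ.solve (g ∷ e ∷ []) ⟩
      2 * g + e + 2                 ≡⟨ cong (λ w → w + 2) n≡2g+e ⟨
      n + 2                         ∎)
      where open ≤-Reasoning
    gδ≡v : + g ℤ.* δ ≡ v
    gδ≡v = n∣i-j∧∣i-j∣<n⇒i≡j n∣gδ-v small
    g∣δ∣<g*1 : g * ∣ δ ∣ < g * 1
    g∣δ∣<g*1 = subst₂ _<_ (trans (cong ∣_∣ (sym gδ≡v)) (ℤ.∣i*j∣≡∣i∣*∣j∣ (+ g) δ)) (sym (*-identityʳ g)) ∣v∣<g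
    δ≡0 : δ ≡ 0ℤ
    δ≡0 = ℤ.∣i∣≡0⇒i≡0 (n<1⇒n≡0 (*-cancelˡ-< g ∣ δ ∣ 1 g∣δ∣<g*1))

  record PositiveWitness (d : ℕ) : Set where
    field
      Z      : ℕ
      ε      : ℤ
      unit   : Unit ε
      2≤Z    : 2 ≤ Z
      Z+2≤2k : Z + 2 ≤ 2 * k
      n∣gZ-εd : + n ∣ + g ℤ.* + Z ℤ.- ε ℤ.* + d

  Witness⇒PositiveWitness : ∀ {d} → 1 ≤ d → d < k → Witness g k n d → PositiveWitness d
  Witness⇒PositiveWitness {d} 1≤d d<k record { z = z ; ∣z∣+2≤2k = ∣z∣+2≤2k ; n∣gz-d = n∣gz-d }
    with +∣i∣≡unit*i z
  ... | ε , u , ∣z∣≡εz = record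
    { Z = ∣ z ∣ ; ε = ε ; unit = u ; 2≤Z = 2≤∣z∣ ; Z+2≤2k = ∣z∣+2≤2k ; n∣gZ-εd = n∣g∣z∣-εd }
    where
    identity : ∀ E G Z D → E ℤ.* (G ℤ.* Z ℤ.- D) ≡ G ℤ.* (E ℤ.* Z) ℤ.- E ℤ.* D
    identity = ℤ.solve-∀
    n∣g∣z∣-εd : + n ∣ + g ℤ.* + ∣ z ∣ ℤ.- ε ℤ.* + d
    n∣g∣z∣-εd = subst (+ n ∣_)
      (trans (identity ε (+ g) z (+ d)) (cong (λ w → + g ℤ.* w ℤ.- ε ℤ.* + d) (sym ∣z∣≡εz)))
      (∣n⇒∣m*n ε n∣gz-d)
    ∣εd∣≡d : ∣ ε ℤ.* + d ∣ ≡ d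
    ∣εd∣≡d = ∣unit*i∣≡∣i∣ u (+ d)
    2≤∣z∣ : 2 ≤ ∣ z ∣
    2≤∣z∣ = ≮⇒≥ λ ∣z∣<2 → <⇒≢ 1≤d (sym (trans (sym ∣εd∣≡d) (cong ∣_∣
      (n∣gδ-v⇒v≡0 (+ ∣ z ∣) (ε ℤ.* + d) (<⇒≤ ∣z∣<2) (subst (λ w → w + 2 ≤ 2 * k) (sym ∣εd∣≡d) (m<n⇒m+2≤2*n d<k))
        n∣g∣z∣-εd))))

  ∣Z₁-Z₂∣≤2⇒d₁≡d₂ : ∀ {d₁ d₂} → d₁ < k → d₂ < k → (W₁ : PositiveWitness d₁) (W₂ : PositiveWitness d₂) →
    ∣ + PositiveWitness.Z W₁ ℤ.- + PositiveWitness.Z W₂ ∣ ≤ 2 → d₁ ≡ d₂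
  ∣Z₁-Z₂∣≤2⇒d₁≡d₂ {d₁} {d₂} d₁<k d₂<k W₁ W₂ ∣Z₁-Z₂∣≤2 =
    trans (sym (∣unit*i∣≡∣i∣ W₁.unit (+ d₁)))
      (trans (cong ∣_∣ (ℤ.i-j≡0⇒i≡j (W₁.ε ℤ.* + d₁) (W₂.ε ℤ.* + d₂)
                         (n∣gδ-v⇒v≡0 (+ W₁.Z ℤ.- + W₂.Z) v ∣Z₁-Z₂∣≤2 ∣v∣+2≤2k n∣g[Z₁-Z₂]-v)))
        (∣unit*i∣≡∣i∣ W₂.unit (+ d₂)))
    where
    module W₁ = PositiveWitness W₁
    module W₂ = PositiveWitness W₂
    v = W₁.ε ℤ.* + d₁ ℤ.- W₂.ε ℤ.* + d₂
    identity : ∀ G Z₁ Z₂ U₁ U₂ → (G ℤ.* Z₁ ℤ.- U₁) ℤ.- (G ℤ.* Z₂ ℤ.- U₂) ≡ G ℤ.* (Z₁ ℤ.- Z₂) ℤ.- (U₁ ℤ.- U₂)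
    identity = ℤ.solve-∀
    n∣g[Z₁-Z₂]-v : + n ∣ + g ℤ.* (+ W₁.Z ℤ.- + W₂.Z) ℤ.- v
    n∣g[Z₁-Z₂]-v = subst (+ n ∣_) (identity (+ g) (+ W₁.Z) (+ W₂.Z) (W₁.ε ℤ.* + d₁) (W₂.ε ℤ.* + d₂))
      (∣m∣n⇒∣m-n W₁.n∣gZ-εd W₂.n∣gZ-εd)
    ∣v∣+2≤2k : ∣ v ∣ + 2 ≤ 2 * k
    ∣v∣+2≤2k = ≤-trans (+-monoˡ-≤ 2 (≤-trans (ℤ.∣i-j∣≤∣i∣+∣j∣ (W₁.ε ℤ.* + d₁) (W₂.ε ℤ.* + d₂))
      (≤-reflexive (cong₂ _+_ (∣unit*i∣≡∣i∣ W₁.unit (+ d₁)) (∣unit*i∣≡∣i∣ W₂.unit (+ d₂))))))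
      (m<o⇒n<o⇒m+n+2≤2*o d₁<k d₂<k)

  few-if-g-and-n∸2g-large : ∀ {L} → 1 ≤ k → Unique L → All (λ d → 1 ≤ d × d < k × Witness g k n d) L →
    3 * length L < 2 * k
  few-if-g-and-n∸2g-large 1≤k u ds =
    ≤-<-trans (*-monoʳ-≤ 3 (length≤-by-code code code-injective u (All.map positive ds))) (begin-strict
      3 * M         ≡⟨ *-comm 3 M ⟩
      M * 3         ≤⟨ m/n*n≤m (2 * k ∸ 1) 3 ⟩
      2 * k ∸ 1     <⟨ ∸-monoʳ-< z<s (≤-trans 1≤k (m≤m+n k (k + 0))) ⟩
      2 * k         ∎)
    where
    open ≤-Reasoning
    M = (2 * k ∸ 1) / 3
    positive : ∀ {d} → 1 ≤ d × d < k × Witness g k n d → d < k × PositiveWitness d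
    positive (1≤d , d<k , W) = d<k , Witness⇒PositiveWitness 1≤d d<k W
    block< : ∀ {d} (W : PositiveWitness d) → (PositiveWitness.Z W ∸ 2) / 3 < M
    block< record { Z = Z ; 2≤Z = 2≤Z ; Z+2≤2k = Z+2≤2k } =
      subst (_≤ M) (m/n≡1+[m∸n]/n {suc Z} {3} (s≤s 2≤Z))
        (/-monoˡ-≤ 3 (m+n≤o⇒m≤o∸n (suc Z) (subst (_≤ 2 * k) (+-suc Z 1) Z+2≤2k)))
    code : ∀ {d} → d < k × PositiveWitness d → Fin M
    code (_ , W) = fromℕ< (block< W)
    code-injective : ∀ {d₁ d₂} (p₁ : d₁ < k × PositiveWitness d₁) (p₂ : d₂ < k × PositiveWitness d₂) →
      code p₁ ≡ code p₂ → d₁ ≡ d₂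
    code-injective (d₁<k , W₁) (d₂<k , W₂) eq = ∣Z₁-Z₂∣≤2⇒d₁≡d₂ d₁<k d₂<k W₁ W₂
      (≤-pred ([a∸c]/m≡[b∸c]/m⇒∣a-b∣<m 3 (PositiveWitness.2≤Z W₁) (PositiveWitness.2≤Z W₂)
        (fromℕ<-injective _ _ (block< W₁) (block< W₂) eq)))

few-differences : ∀ {n k g L} .{{_ : NonZero n}} → 1 ≤ k → 18 * k < n → 1 < g → 2 * g ≤ n →
  Unique L → All (λ d → 1 ≤ d × d < k × Difference g k n d) L → 3 * length L < 2 * k
few-differences {n} {k} {g} {L} 1≤k 18k<n 1<g 2g≤n u ds =
  by-size (g + 2 ≤? 2 * k) (n ∸ 2 * g) (sym (m+[n∸m]≡n 2g≤n))
  where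
  c*k<n : ∀ c → c ≤ 18 → c * k < n
  c*k<n c c≤18 = ≤-<-trans (*-monoˡ-≤ k c≤18) 18k<n
  ws : All (λ d → 1 ≤ d × d < k × Witness g k n d) L
  ws = All.map (λ (1≤d , d<k , D) → 1≤d , d<k , Difference⇒Witness D) ds
  none : ∀ {L} → n ≡ 2 * g → All (λ d → 1 ≤ d × d < k × Witness g k n d) L → length L ≡ 0
  none _ All.[] = refl
  none n≡2g ((1≤d , d<k , W) All.∷ _) =
    contradiction W (no-Witness-if-n≡2g n≡2g 1≤d (<-≤-trans (*-monoʳ-< 2 d<k) (<⇒≤ (c*k<n 2 (s≤s (s≤s z≤n))))))
  by-size : Dec (g + 2 ≤ 2 * k) → ∀ e → n ≡ 2 * g + e → 3 * length L < 2 * k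
  by-size (yes g+2≤2k) _ _ = few-in-residue-classes {{>-nonZero (<-trans z<s 1<g)}} (ℤ.- + n) 1<g g+2≤2k u
    (All.map (λ (1≤d , d<k , W) → 1≤d , d<k , Witness⇒residue-mod-g 18k<n d<k W) ws)
  by-size (no _) 0 n≡2g+0 = subst (λ l → 3 * l < 2 * k) (sym (none (trans n≡2g+0 (+-identityʳ (2 * g))) ws))
    (≤-trans 1≤k (m≤m+n k (k + 0)))
  by-size (no _) 1 n≡2g+1 = few-if-2d+2≤k 1≤k u
    (All.map (λ (1≤d , d<k , D) → 1≤d , Difference⇒2d+2≤k n≡2g+1 (<⇒≤ (c*k<n 4 (s≤s (s≤s (s≤s (s≤s z≤n)))))) d<k D) ds)
  by-size (no g+2≰2k) e@(suc (suc _)) n≡2g+e with e + 2 ≤? 2 * k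
  ... | yes e+2≤2k = few-in-residue-classes (+ g) (s≤s (s≤s z≤n)) e+2≤2k u
    (All.map (λ (1≤d , d<k , W) → 1≤d , d<k , Witness⇒residue-mod-e n≡2g+e 18k<n d<k W) ws)
  ... | no e+2≰2k = few-if-g-and-n∸2g-large n≡2g+e (≰⇒> g+2≰2k) (≰⇒> e+2≰2k) 1≤k u ws

lemma3p3 : (n k g : ℕ) → .{{_ : NonZero n}} → 1 ≤ k → 1 ≤ g →
    18 * k < n → 1 < g → 2 * g ≤ n →
    3 * countD g k n < 2 * k
lemma3p3 n k g 1≤k _ 18k<n 1<g 2g≤n =
  few-differences 1≤k 18k<n 1<g 2g≤n (Unique.filter⁺ _ (range1-unique k)) (differences g k n)
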